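{- Let $G$ be a co-biconvex graph without universal vertices, with partition $(C_1,C_2)$ and auxiliary interval graphs $H_1,H_2$ as described in the context. Let $i\in\{1,2\}$, $j$ the other index, and $S\subseteq C_i$. Then $S$ is a stable set of $H_i$ if and only if $|N_G[v]\cap S|\geq |S|-1$ for every $v\in C_j$ (i.e. $S$ is an $(|S|-1)$-tuple dominating set of $G_j=G[C_j]$ in the sense of the context).
   Context: For a graph $G$ with vertices $v_1,\dots,v_n$, $M^*(G)$ is the $0,1$-matrix with entry $(i,j)=1$ iff $i=j$ or $v_iv_j\in E(G)$. $G$ is co-biconvex if the rows of $M^*(G)$ can be permuted so the 0's in every column are consecutive. Fix an ordering $v_1,\dots,v_n$ (rows and columns of $M^*(G)$ in this order) in which the 0's of each column are consecutive; $C_1$ is the set of vertices whose column has its 0's below the diagonal and $C_2$ those whose column has its 0's above; with no universal vertices they partition $V(G)$, are cliques, and we may take $C_1=\{v_1,\dots,v_r\}$, $C_2=\{v_{r+1},\dots,v_n\}$. For $v_i\in C_1$ (resp. $C_2$), if the 0's of column $i$ occupy rows $p,\dots,p+s$, set $I_i=[p,p+s]$. $H_1$ is the intersection graph of $\{I_i: v_i\in C_1\}$ (vertex set $C_1$) and $H_2$ that of $\{I_i:v_i\in C_2\}$ (vertex set $C_2$). A set $S$ is said to be a $t$-tuple dominating set of $G_j$ if every $v\in C_j$ satisfies $|N_G[v]\cap S|\geq t$, where $N_G[v]$ is the closed neighborhood in $G$. -}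

module Defs where

open import Data.Nat using (ℕ; _<_; _≤_)
open import Data.Fin using (Fin; toℕ; _≟_)
open import Data.Fin.Subset using (Subset; _∈_; _∩_; ∣_∣)
open import Data.Vec using (tabulate)
open import Data.Bool using (Bool; true; false; _∨_)
open import Data.Product using (_×_; ∃)
open import Relation.Nullary using (¬_)
open import Relation.Nullary.Decidable using (⌊_⌋)
open import Relation.Binary.PropositionalEquality using (_≡_; _≢_)

-- A finite simple graph on vertices v_1,…,v_n, indexed by Fin n in the
-- fixed ordering (row/column order of M*(G)).
record Graph (n : ℕ) : Set where
  field
    adj    : Fin n → Fin n → Bool
    sym    : ∀ u v → adj u v ≡ adj v u
    irrefl : ∀ v → adj v v ≡ false

data Part : Set where
  one two : Part

other : Part → Part
other one = two
other two = one

module _ {n : ℕ} (G : Graph n) where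
  open Graph G

  M* : Fin n → Fin n → Bool
  M* i j = ⌊ i ≟ j ⌋ ∨ adj i j

  Universal : Fin n → Set
  Universal v = ∀ u → u ≢ v → adj u v ≡ true

  ConsecutiveZeros : Set
  ConsecutiveZeros = ∀ j a b c → toℕ a ≤ toℕ b → toℕ b ≤ toℕ c →
    M* a j ≡ false → M* c j ≡ false → M* b j ≡ false

  InC : Part → Fin n → Set
  InC one j = (∃ λ i → M* i j ≡ false) × (∀ i → M* i j ≡ false → toℕ j < toℕ i)
  InC two j = (∃ λ i → M* i j ≡ false) × (∀ i → M* i j ≡ false → toℕ i < toℕ j)

  -- Row k lies in I_j, the interval of rows occupied by the 0's of column j.
  InInterval : Fin n → Fin n → Set
  InInterval j k = M* k j ≡ false

  HAdj : Part → Fin n → Fin n → Set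
  HAdj p a b = InC p a × InC p b × a ≢ b × ∃ λ k → InInterval a k × InInterval b k

  -- S is a stable set of H_p (S ⊆ C_p assumed separately).
  StableH : Part → Subset n → Set
  StableH p S = ∀ a b → a ∈ S → b ∈ S → ¬ HAdj p a b

  ClosedNbhd : Fin n → Subset n
  ClosedNbhd v = tabulate (λ u → M* u v)

  TupleDominating : ℕ → Part → Subset n → Set
  TupleDominating t p S = ∀ v → InC p v → t ≤ ∣ ClosedNbhd v ∩ S ∣

-- Let q be the part other than p. For v ∈ C_q, the vertices of S outside
-- N_G[v] are exactly the a ∈ S whose interval I_a contains row v, and
-- |N_G[v] ∩ S| = |S| − |S ─ N_G[v]|; so S is (|S| − 1)-tuple dominating for
-- G_q iff every row of C_q lies in at most one interval I_a (a ∈ S). Since C_p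
-- is a clique, every row of an interval I_a with a ∈ C_p lies in C_q, so two
-- intervals of S meet iff they share a row of C_q, i.e. iff S is not stable
-- in H_p.

module Submission where

open import Defs
open import Data.Bool using (true)
open import Data.Bool.Properties using (¬-not)
open import Data.Fin using (Fin; toℕ; _≟_)
open import Data.Fin.Subset using (Subset; _∈_; _∉_; ∣_∣; _∩_; _─_; _-_; ⁅_⁆; inside; outside)
open import Data.Fin.Subset.Properties using (nonempty?; Empty-unique; ∣⊥∣≡0; ∣⁅x⁆∣≡1; x∈⁅x⁆; p⊆q⇒∣p∣≤∣q∣; x∈p⇒∣p-x∣<∣p∣; x∈p∧x≢y⇒x∈p-y; x∈p∧x∉q⇒x∈p─q; p─q⊆p)
open import Data.Nat using (ℕ; suc; _+_; _∸_; _<_; _≤_; z≤n; s≤s; _<?_)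
open import Data.Nat.Properties using (≤-reflexive; ≤-trans; <-asym; ≮⇒≥; +-suc; +-comm; +-monoʳ-≤; +-cancelˡ-≤; m≤n+o⇒m∸n≤o; m≤n+m∸n; module ≤-Reasoning)
open import Data.Product using (_×_; _,_; proj₁; proj₂)
open import Data.Sum using (_⊎_; inj₁; inj₂)
open import Data.Vec using (_∷_; []; here; there)
open import Data.Vec.Properties using ([]=⇒lookup; lookup⇒[]=; lookup∘tabulate)
open import Function using (_∘_)
open import Function.Bundles using (_⇔_; mk⇔; Equivalence)
import Function.Properties.Equivalence as ⇔
open import Relation.Binary.PropositionalEquality using (_≡_; refl; sym; trans; cong; subst)
open import Relation.Nullary using (¬_; yes; no; contradiction)

private
  variable
    n : ℕ

Subsingleton : Subset n → Set
Subsingleton p = ∀ x y → x ∈ p → y ∈ p → x ≡ y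

∣p∣≤1⇔Subsingleton : {n : ℕ} (p : Subset n) → ∣ p ∣ ≤ 1 ⇔ Subsingleton p
∣p∣≤1⇔Subsingleton {n} p = mk⇔ atMostOne⇒subsingleton subsingleton⇒atMostOne
  where
  atMostOne⇒subsingleton : ∣ p ∣ ≤ 1 → Subsingleton p
  atMostOne⇒subsingleton ∣p∣≤1 x y x∈p y∈p with x ≟ y
  ... | yes x≡y = x≡y
  ... | no  x≢y = contradiction (≤-trans two≤∣p∣ ∣p∣≤1) λ { (s≤s ()) }
    where
    one≤∣p-x∣ : 1 ≤ ∣ p - x ∣
    one≤∣p-x∣ = ≤-trans (s≤s z≤n) (x∈p⇒∣p-x∣<∣p∣ (x∈p∧x≢y⇒x∈p-y y∈p (x≢y ∘ sym)))

    two≤∣p∣ : 2 ≤ ∣ p ∣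
    two≤∣p∣ = ≤-trans (s≤s one≤∣p-x∣) (x∈p⇒∣p-x∣<∣p∣ x∈p)

  subsingleton⇒atMostOne : Subsingleton p → ∣ p ∣ ≤ 1
  subsingleton⇒atMostOne unique with nonempty? p
  ... | no  empty = ≤-trans (≤-reflexive (trans (cong ∣_∣ (Empty-unique empty)) (∣⊥∣≡0 n))) z≤n
  ... | yes (x , x∈p) = subst (∣ p ∣ ≤_) (∣⁅x⁆∣≡1 x) (p⊆q⇒∣p∣≤∣q∣ p⊆⁅x⁆)
    where
    p⊆⁅x⁆ : ∀ {y} → y ∈ p → y ∈ ⁅ x ⁆
    p⊆⁅x⁆ {y} y∈p = subst (_∈ ⁅ x ⁆) (unique x y x∈p y∈p) (x∈⁅x⁆ x)

∣p∣≡∣q∩p∣+∣p─q∣ : (p q : Subset n) → ∣ p ∣ ≡ ∣ q ∩ p ∣ + ∣ p ─ q ∣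
∣p∣≡∣q∩p∣+∣p─q∣ []            []            = refl
∣p∣≡∣q∩p∣+∣p─q∣ (outside ∷ p) (outside ∷ q) = ∣p∣≡∣q∩p∣+∣p─q∣ p q
∣p∣≡∣q∩p∣+∣p─q∣ (outside ∷ p) (inside  ∷ q) = ∣p∣≡∣q∩p∣+∣p─q∣ p q
∣p∣≡∣q∩p∣+∣p─q∣ (inside  ∷ p) (inside  ∷ q) = cong suc (∣p∣≡∣q∩p∣+∣p─q∣ p q)
∣p∣≡∣q∩p∣+∣p─q∣ (inside  ∷ p) (outside ∷ q) =
  trans (cong suc (∣p∣≡∣q∩p∣+∣p─q∣ p q)) (sym (+-suc ∣ q ∩ p ∣ ∣ p ─ q ∣))

x∈p─q⇒x∉q : {p q : Subset n} {x : Fin n} → x ∈ p ─ q → x ∉ q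
x∈p─q⇒x∉q {p = _ ∷ _} {outside ∷ _} here        ()
x∈p─q⇒x∉q {p = _ ∷ _} {_       ∷ _} (there x∈) (there x∈q) = x∈p─q⇒x∉q x∈ x∈q

m+n∸1≤m⇔n≤1 : (m n : ℕ) → m + n ∸ 1 ≤ m ⇔ n ≤ 1
m+n∸1≤m⇔n≤1 m n = mk⇔ to from
  where
  to : m + n ∸ 1 ≤ m → n ≤ 1
  to le = +-cancelˡ-≤ m n 1 (begin
    m + n           ≤⟨ m≤n+m∸n (m + n) 1 ⟩
    1 + (m + n ∸ 1) ≤⟨ s≤s le ⟩
    1 + m           ≡⟨ +-comm 1 m ⟩
    m + 1           ∎)
    where open ≤-Reasoning

  from : n ≤ 1 → m + n ∸ 1 ≤ m
  from n≤1 = m≤n+o⇒m∸n≤o (m + n) 1 (≤-trans (+-monoʳ-≤ m n≤1) (≤-reflexive (+-comm m 1)))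

∣p∣∸1≤∣q∩p∣⇔Subsingleton[p─q] : (p q : Subset n) → ∣ p ∣ ∸ 1 ≤ ∣ q ∩ p ∣ ⇔ Subsingleton (p ─ q)
∣p∣∸1≤∣q∩p∣⇔Subsingleton[p─q] p q rewrite ∣p∣≡∣q∩p∣+∣p─q∣ p q =
  ⇔.trans (m+n∸1≤m⇔n≤1 ∣ q ∩ p ∣ ∣ p ─ q ∣) (∣p∣≤1⇔Subsingleton (p ─ q))

module _ (G : Graph n) where
  M*-sym : ∀ i j → M* G i j ≡ M* G j i
  M*-sym i j with i ≟ j | j ≟ i
  ... | yes refl | yes _    = refl
  ... | yes refl | no  j≢i  = contradiction refl j≢i
  ... | no  i≢j  | yes refl = contradiction refl i≢j
  ... | no  _    | no  _    = Graph.sym G i j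

  ∉ClosedNbhd⇔InInterval : ∀ {u v} → u ∉ ClosedNbhd G v ⇔ InInterval G u v
  ∉ClosedNbhd⇔InInterval {u} {v} = mk⇔ to from
    where
    to : u ∉ ClosedNbhd G v → InInterval G u v
    to u∉N = trans (M*-sym v u) (¬-not λ M*uv≡true →
      u∉N (lookup⇒[]= u _ (trans (lookup∘tabulate (λ w → M* G w v) u) M*uv≡true)))

    from : InInterval G u v → u ∉ ClosedNbhd G v
    from v∈Iu u∈N = contradiction (trans (sym v∈Iu) (trans (M*-sym v u) M*uv≡true)) λ ()
      where
      M*uv≡true : M* G u v ≡ true
      M*uv≡true = trans (sym (lookup∘tabulate (λ w → M* G w v) u)) ([]=⇒lookup u∈N)

  ∈─ClosedNbhd⇔ : ∀ {S x v} → x ∈ S ─ ClosedNbhd G v ⇔ (x ∈ S × InInterval G x v)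
  ∈─ClosedNbhd⇔ {S} {x} {v} = mk⇔
    (λ x∈ → p─q⊆p S (ClosedNbhd G v) x∈ , Equivalence.to ∉ClosedNbhd⇔InInterval (x∈p─q⇒x∉q x∈))
    (λ (x∈S , v∈Ix) → x∈p∧x∉q⇒x∈p─q x∈S (Equivalence.from ∉ClosedNbhd⇔InInterval v∈Ix))

  tupleDominating⇔ : ∀ q (S : Subset n) →
    TupleDominating G (∣ S ∣ ∸ 1) q S ⇔ (∀ v → InC G q v → Subsingleton (S ─ ClosedNbhd G v))
  tupleDominating⇔ q S = mk⇔
    (λ dom v v∈Cq → Equivalence.to   (counting v) (dom v v∈Cq))
    (λ sub v v∈Cq → Equivalence.from (counting v) (sub v v∈Cq))
    where
    counting : ∀ v → ∣ S ∣ ∸ 1 ≤ ∣ ClosedNbhd G v ∩ S ∣ ⇔ Subsingleton (S ─ ClosedNbhd G v)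
    counting v = ∣p∣∸1≤∣q∩p∣⇔Subsingleton[p─q] S (ClosedNbhd G v)

  ¬InInterval-samePart : ∀ p {a k} → InC G p a → InC G p k → ¬ InInterval G a k
  ¬InInterval-samePart one (_ , a<) (_ , k<) k∈Ia = <-asym (a< _ k∈Ia) (k< _ (trans (M*-sym _ _) k∈Ia))
  ¬InInterval-samePart two (_ , a<) (_ , k<) k∈Ia = <-asym (a< _ k∈Ia) (k< _ (trans (M*-sym _ _) k∈Ia))

  module _ (covers : ∀ v → InC G one v ⊎ InC G two v) where

    InInterval⇒InC-other : ∀ p {a k} → InC G p a → InInterval G a k → InC G (other p) k
    InInterval⇒InC-other p {a} {k} a∈Cp k∈Ia with p | covers k
    ... | one | inj₂ k∈C₂ = k∈C₂
    ... | two | inj₁ k∈C₁ = k∈C₁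
    ... | one | inj₁ k∈C₁ = contradiction k∈Ia (¬InInterval-samePart one a∈Cp k∈C₁)
    ... | two | inj₂ k∈C₂ = contradiction k∈Ia (¬InInterval-samePart two a∈Cp k∈C₂)

    stableH⇔ : ∀ p (S : Subset n) → (∀ a → a ∈ S → InC G p a) →
      StableH G p S ⇔ (∀ v → InC G (other p) v → Subsingleton (S ─ ClosedNbhd G v))
    stableH⇔ p S S⊆Cp = mk⇔ to from
      where
      to : StableH G p S → ∀ v → InC G (other p) v → Subsingleton (S ─ ClosedNbhd G v)
      to stable v _ a b a∈ b∈ with a ≟ b | Equivalence.to ∈─ClosedNbhd⇔ a∈ | Equivalence.to ∈─ClosedNbhd⇔ b∈
      ... | yes a≡b | _ | _ = a≡b
      ... | no  a≢b | a∈S , v∈Ia | b∈S , v∈Ib =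
        contradiction (S⊆Cp a a∈S , S⊆Cp b b∈S , a≢b , v , v∈Ia , v∈Ib) (stable a b a∈S b∈S)

      from : (∀ v → InC G (other p) v → Subsingleton (S ─ ClosedNbhd G v)) → StableH G p S
      from sub a b a∈S b∈S (a∈Cp , _ , a≢b , v , v∈Ia , v∈Ib) =
        a≢b (sub v (InInterval⇒InC-other p a∈Cp v∈Ia) a b
               (Equivalence.from ∈─ClosedNbhd⇔ (a∈S , v∈Ia)) (Equivalence.from ∈─ClosedNbhd⇔ (b∈S , v∈Ib)))

proposition4p5 : (n : ℕ) (G : Graph n) → ConsecutiveZeros G →
    (∀ v → ¬ Universal G v) →
    (r : ℕ) → (∀ v → (InC G one v ⇔ toℕ v < r) × (InC G two v ⇔ r ≤ toℕ v)) →
    (p : Part) (S : Subset n) → (∀ a → a ∈ S → InC G p a) →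
    (StableH G p S ⇔ TupleDominating G (∣ S ∣ ∸ 1) (other p) S)
-- Consecutive zeros and the absence of universal vertices are what make (C₁, C₂)
-- a partition in the paper; here the hypothesis on r already provides it.
proposition4p5 n G _ _ r partition p S S⊆Cp =
  ⇔.trans (stableH⇔ G covers p S S⊆Cp) (⇔.sym (tupleDominating⇔ G (other p) S))
  where
  covers : ∀ v → InC G one v ⊎ InC G two v
  covers v with toℕ v <? r
  ... | yes v<r = inj₁ (Equivalence.from (proj₁ (partition v)) v<r)
  ... | no  v≮r = inj₂ (Equivalence.from (proj₂ (partition v)) (≮⇒≥ v≮r))
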